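{- Let $G=(C\cup I,E)$ be a split graph with clique $C$ and independent set $I$, and let $I_s$ and $I_t$ be two independent sets of $G$ of size $k$. Then there is a reconfiguration sequence from $I_s$ to $I_t$ under Token Sliding if and only if there is one under $(k,1)$-Token Jumping.
   Context: A split graph is a graph whose vertex set is partitioned into a clique $C$ and an independent set $I$. A configuration is a set of $k$ vertices (tokens on distinct vertices). A Token Sliding move (equivalently a $(1,1)$-Token Jumping move) moves a single token to an adjacent vertex not occupied by another token. A move under $(k,1)$-Token Jumping from configuration $D$ to $D'$ is a bijection $f: D\to D'$ with $\mathrm{dist}_G(v,f(v))\leq 1$ for all $v\in D$. A reconfiguration sequence is a sequence of configurations, each an independent set of size $k$, with a move between every two consecutive ones. -}

module Defs where

open import Data.Nat using (ℕ)
open import Data.Fin using (Fin)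
open import Data.Fin.Subset using (Subset; _∈_; _∉_; ∣_∣; inside; outside)
open import Data.Vec using (_[_]≔_)
open import Data.Bool using (Bool; true; false)
open import Data.Product using (Σ; _×_; ∃; ∃-syntax; proj₁)
open import Data.Sum using (_⊎_)
open import Relation.Nullary using (¬_; Dec)
open import Relation.Binary.PropositionalEquality using (_≡_; _≢_; setoid)
open import Relation.Binary.Construct.Closure.ReflexiveTransitive using (Star)
open import Function.Bundles using (Bijection)

record Graph (n : ℕ) : Set₁ where
  field
    Adj     : Fin n → Fin n → Set
    adj?    : ∀ u v → Dec (Adj u v)
    sym     : ∀ {u v} → Adj u v → Adj v u
    irrefl  : ∀ {u} → ¬ Adj u u
open Graph public

record SplitGraph (n : ℕ) : Set₁ where
  field
    graph     : Graph n
    inC       : Fin n → Bool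
    C-clique  : ∀ u v → inC u ≡ true → inC v ≡ true → u ≢ v → Adj graph u v
    I-indep   : ∀ u v → inC u ≡ false → inC v ≡ false → ¬ Adj graph u v
open SplitGraph public

module _ {n : ℕ} (G : Graph n) where

  Independent : Subset n → Set
  Independent D = ∀ u v → u ∈ D → v ∈ D → ¬ Adj G u v

  IndepOfSize : ℕ → Subset n → Set
  IndepOfSize k D = Independent D × ∣ D ∣ ≡ k

  TSMove : Subset n → Subset n → Set
  TSMove D D' = ∃[ u ] ∃[ v ] (u ∈ D × v ∉ D × Adj G u v × D' ≡ (D [ u ]≔ outside) [ v ]≔ inside)

  Elems : Subset n → Set
  Elems D = Σ (Fin n) (_∈ D)

  Dist≤1 : Fin n → Fin n → Set
  Dist≤1 u v = u ≡ v ⊎ Adj G u v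

  TJMove : Subset n → Subset n → Set
  TJMove D D' = Σ (Bijection (setoid (Elems D)) (setoid (Elems D')))
                  (λ f → ∀ x → Dist≤1 (proj₁ x) (proj₁ (Bijection.to f x)))

  Step : ℕ → (Subset n → Subset n → Set) → Subset n → Subset n → Set
  Step k M D D' = IndepOfSize k D × IndepOfSize k D' × M D D'

  Reconf : ℕ → (Subset n → Subset n → Set) → Subset n → Subset n → Set
  Reconf k M Is It = IndepOfSize k Is × IndepOfSize k It × Star (Step k M) Is It

{-# OPTIONS --safe #-}
module Submission where

-- In a split graph an independent set holds at most one clique
-- vertex, so at most one token starts in C, and every token leaving I lands in C, hence on
-- the single clique vertex of the target: at most one token leaves I.  Sliding the clique
-- token first and the token leaving I second keeps every intermediate configuration
-- independent, so each jump is realised by at most two slides.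

open import Defs renaming (sym to Adj-sym)
open import Data.Nat using (ℕ; suc)
open import Data.Fin using (Fin; zero; suc; _≟_)
open import Data.Fin.Properties using (any?)
open import Data.Fin.Subset using (Subset; _∈_; _∉_; ∣_∣; inside; outside)
open import Data.Fin.Subset.Properties using (_∈?_; ⊆-antisym)
open import Data.Vec using (_∷_; _[_]≔_)
open import Data.Vec.Base using (here; there)
open import Data.Vec.Properties using ([]=⇒lookup; lookup⇒[]=; []≔-updates; []≔-minimal; lookup∘update; lookup∘update′)
open import Data.Vec.Properties.WithK using ([]=-irrelevant)
open import Data.Bool using (true; false)
open import Data.Bool.Properties using (¬-not) renaming (_≟_ to _≟ᵇ_)
open import Data.Product using (_×_; _,_; ∃; ∃-syntax; proj₁; proj₂; uncurry)
open import Data.Sum using (inj₁; inj₂)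
open import Relation.Nullary using (¬_; yes; no; contradiction)
open import Relation.Nullary.Decidable using (_×-dec_; ¬?)
open import Relation.Unary using (Decidable)
open import Relation.Binary.PropositionalEquality using (_≡_; _≢_; refl; sym; trans; cong; subst)
open import Relation.Binary.Construct.Closure.ReflexiveTransitive using (Star; ε; _◅_; map; concat)
open import Function using (id; _∘_)
open import Function.Bundles using (Bijection; mk⤖)
open import Function.Consequences.Propositional using (strictlySurjective⇒surjective)

∈-[]≔⁻ : ∀ {n} {p : Subset n} {x y b} → y ≢ x → y ∈ p [ x ]≔ b → y ∈ p
∈-[]≔⁻ {p = p} {y = y} {b} y≢x y∈ =
  lookup⇒[]= y p (trans (sym (lookup∘update′ y≢x p b)) ([]=⇒lookup y∈))

x∉p[x]≔outside : ∀ {n} (p : Subset n) x → x ∉ p [ x ]≔ outside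
x∉p[x]≔outside p x x∈ with () ← trans (sym (lookup∘update x p outside)) ([]=⇒lookup x∈)

x∈p⇒1+∣p[x]≔outside∣≡∣p∣ : ∀ {n} {p : Subset n} {x} → x ∈ p → suc ∣ p [ x ]≔ outside ∣ ≡ ∣ p ∣
x∈p⇒1+∣p[x]≔outside∣≡∣p∣ here = refl
x∈p⇒1+∣p[x]≔outside∣≡∣p∣ {p = inside ∷ p} (there x∈p) = cong suc (x∈p⇒1+∣p[x]≔outside∣≡∣p∣ x∈p)
x∈p⇒1+∣p[x]≔outside∣≡∣p∣ {p = outside ∷ p} (there x∈p) = x∈p⇒1+∣p[x]≔outside∣≡∣p∣ x∈p

x∉p⇒∣p[x]≔inside∣≡1+∣p∣ : ∀ {n} (p : Subset n) x → x ∉ p → ∣ p [ x ]≔ inside ∣ ≡ suc ∣ p ∣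
x∉p⇒∣p[x]≔inside∣≡1+∣p∣ (outside ∷ p) zero x∉p = refl
x∉p⇒∣p[x]≔inside∣≡1+∣p∣ (inside ∷ p) zero x∉p = contradiction here x∉p
x∉p⇒∣p[x]≔inside∣≡1+∣p∣ (inside ∷ p) (suc x) x∉p = cong suc (x∉p⇒∣p[x]≔inside∣≡1+∣p∣ p x (x∉p ∘ there))
x∉p⇒∣p[x]≔inside∣≡1+∣p∣ (outside ∷ p) (suc x) x∉p = x∉p⇒∣p[x]≔inside∣≡1+∣p∣ p x (x∉p ∘ there)

module _ {n : ℕ} where

  slide : Fin n → Fin n → Subset n → Subset n
  slide u v D = (D [ u ]≔ outside) [ v ]≔ inside

  v∈slide : ∀ u v D → v ∈ slide u v D
  v∈slide u v D = []≔-updates (D [ u ]≔ outside) v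

  ∈slide⁺ : ∀ {u v D w} → w ∈ D → w ≢ u → w ∈ slide u v D
  ∈slide⁺ {u} {v} {D} {w} w∈D w≢u with w ≟ v
  ... | yes refl = v∈slide u v D
  ... | no w≢v = []≔-minimal _ w v w≢v ([]≔-minimal D w u w≢u w∈D)

  ∈slide⁻ : ∀ {u v D w} → w ∈ slide u v D → w ≢ v → w ∈ D × w ≢ u
  ∈slide⁻ {u} {v} {D} {w} w∈ w≢v with w ≟ u
  ... | yes refl = contradiction (∈-[]≔⁻ w≢v w∈) (x∉p[x]≔outside D u)
  ... | no w≢u = ∈-[]≔⁻ w≢u (∈-[]≔⁻ w≢v w∈) , w≢u

  ∣slide∣ : ∀ {u v D} → u ∈ D → v ∉ D → ∣ slide u v D ∣ ≡ ∣ D ∣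
  ∣slide∣ {u} {v} {D} u∈D v∉D =
    trans (x∉p⇒∣p[x]≔inside∣≡1+∣p∣ (D [ u ]≔ outside) v v∉D[u]≔outside) (x∈p⇒1+∣p[x]≔outside∣≡∣p∣ u∈D)
    where
    v∉D[u]≔outside : v ∉ D [ u ]≔ outside
    v∉D[u]≔outside with v ≟ u
    ... | yes refl = x∉p[x]≔outside D u
    ... | no v≢u = v∉D ∘ ∈-[]≔⁻ v≢u

  _[_↦_] : (Fin n → Fin n) → Fin n → Fin n → Fin n → Fin n
  (h [ x ↦ y ]) w with w ≟ x
  ... | yes _ = y
  ... | no _ = h w

  [↦]-at : ∀ h x y → (h [ x ↦ y ]) x ≡ y
  [↦]-at h x y with x ≟ x
  ... | yes _ = refl
  ... | no x≢x = contradiction refl x≢x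

  [↦]-other : ∀ h {x y w} → w ≢ x → (h [ x ↦ y ]) w ≡ h w
  [↦]-other h {x} {w = w} w≢x with w ≟ x
  ... | yes w≡x = contradiction w≡x w≢x
  ... | no _ = refl

module _ {n : ℕ} (g : Graph n) where

  -- A (k,1)-jump from D to D' as a total vertex map; its values off D are irrelevant.
  record TokenMap (D D' : Subset n) (h : Fin n → Fin n) : Set where
    field
      maps-into  : ∀ {w} → w ∈ D → h w ∈ D'
      near       : ∀ {w} → w ∈ D → Dist≤1 g w (h w)
      injective  : ∀ {w w'} → w ∈ D → w' ∈ D → h w ≡ h w' → w ≡ w'
      surjective : ∀ {y} → y ∈ D' → ∃[ w ] (w ∈ D × h w ≡ y)
  open TokenMap

  Moves : Subset n → (Fin n → Fin n) → Fin n → Set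
  Moves D h w = w ∈ D × h w ≢ w

  moves? : ∀ D h → Decidable (Moves D h)
  moves? D h w = (w ∈? D) ×-dec ¬? (h w ≟ w)

  Elems-≡ : ∀ {D} {x y : Elems g D} → proj₁ x ≡ proj₁ y → x ≡ y
  Elems-≡ {x = w , p} {.w , q} refl = cong (w ,_) ([]=-irrelevant p q)

  tokenMap⇒tjMove : ∀ {D D' h} → TokenMap D D' h → TJMove g D D'
  tokenMap⇒tjMove {D} {D'} {h} tm =
    mk⤖ (injective′ , strictlySurjective⇒surjective surjective′) , near tm ∘ proj₂
    where
    to : Elems g D → Elems g D'
    to (w , w∈D) = h w , maps-into tm w∈D
    injective′ : ∀ {x y} → to x ≡ to y → x ≡ y
    injective′ {_ , p} {_ , q} eq = Elems-≡ (injective tm p q (cong proj₁ eq))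
    surjective′ : ∀ y → ∃ λ x → to x ≡ y
    surjective′ (_ , y∈D') with surjective tm y∈D'
    ... | w , w∈D , hw≡y = (w , w∈D) , Elems-≡ hw≡y

  tjMove⇒tokenMap : ∀ {D D'} → TJMove g D D' → ∃ (TokenMap D D')
  tjMove⇒tokenMap {D} {D'} (f , f-near) = h , record
    { maps-into  = λ {w} w∈D → subst (_∈ D') (sym (h-on-D w∈D)) (proj₂ (to (w , w∈D)))
    ; near       = λ {w} w∈D → subst (Dist≤1 g w) (sym (h-on-D w∈D)) (f-near (w , w∈D))
    ; injective  = λ p q eq → cong proj₁ (Bijection.injective f
                     (Elems-≡ (trans (sym (h-on-D p)) (trans eq (h-on-D q)))))
    ; surjective = λ y∈D' → let ((w , w∈D) , eq) = Bijection.strictlySurjective f (_ , y∈D')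
                            in w , w∈D , trans (h-on-D w∈D) (cong proj₁ eq)
    }
    where
    to : Elems g D → Elems g D'
    to = Bijection.to f
    h : Fin n → Fin n
    h w with w ∈? D
    ... | yes w∈D = proj₁ (to (w , w∈D))
    ... | no _ = w
    h-on-D : ∀ {w} (w∈D : w ∈ D) → h w ≡ proj₁ (to (w , w∈D))
    h-on-D {w} w∈D with w ∈? D
    ... | yes p = cong (λ q → proj₁ (to (w , q))) ([]=-irrelevant p w∈D)
    ... | no w∉D = contradiction w∈D w∉D

  slide-tokenMap : ∀ {D u v} → u ∈ D → v ∉ D → Adj g u v → TokenMap D (slide u v D) (id [ u ↦ v ])
  slide-tokenMap {D} {u} {v} u∈D v∉D u~v = record
    { maps-into  = maps-into′
    ; near       = near′
    ; injective  = injective′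
    ; surjective = surjective′
    }
    where
    maps-into′ : ∀ {w} → w ∈ D → (id [ u ↦ v ]) w ∈ slide u v D
    maps-into′ {w} w∈D with w ≟ u
    ... | yes _ = v∈slide u v D
    ... | no w≢u = ∈slide⁺ w∈D w≢u
    near′ : ∀ {w} → w ∈ D → Dist≤1 g w ((id [ u ↦ v ]) w)
    near′ {w} _ with w ≟ u
    ... | yes refl = inj₂ u~v
    ... | no _ = inj₁ refl
    injective′ : ∀ {w w'} → w ∈ D → w' ∈ D → (id [ u ↦ v ]) w ≡ (id [ u ↦ v ]) w' → w ≡ w'
    injective′ {w} {w'} w∈D w'∈D eq with w ≟ u | w' ≟ u
    ... | yes refl | yes refl = refl
    ... | yes _    | no _     = contradiction (subst (_∈ D) (sym eq) w'∈D) v∉D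
    ... | no _     | yes _    = contradiction (subst (_∈ D) eq w∈D) v∉D
    ... | no _     | no _     = eq
    surjective′ : ∀ {y} → y ∈ slide u v D → ∃[ w ] (w ∈ D × (id [ u ↦ v ]) w ≡ y)
    surjective′ {y} y∈ with y ≟ v
    ... | yes refl = u , u∈D , [↦]-at id u v
    ... | no y≢v with ∈slide⁻ y∈ y≢v
    ...   | y∈D , y≢u = y , y∈D , [↦]-other id y≢u

  tsStep⇒tjStep : ∀ {k D D'} → Step g k (TSMove g) D D' → Step g k (TJMove g) D D'
  tsStep⇒tjStep (iD , iD' , _ , _ , u∈D , v∉D , u~v , refl) =
    iD , iD' , tokenMap⇒tjMove (slide-tokenMap u∈D v∉D u~v)

  mover-adj : ∀ {D D' h w} → TokenMap D D' h → Moves D h w → Adj g w (h w)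
  mover-adj tm (w∈D , hw≢w) with near tm w∈D
  ... | inj₁ w≡hw = contradiction (sym w≡hw) hw≢w
  ... | inj₂ w~hw = w~hw

  mover-target∉ : ∀ {D D' h w} → Independent g D → TokenMap D D' h → Moves D h w → h w ∉ D
  mover-target∉ {w = w} indD tm mw hw∈D = indD w _ (proj₁ mw) hw∈D (mover-adj tm mw)

  no-mover⇒≡ : ∀ {D D' h} → TokenMap D D' h → (∀ {w} → ¬ Moves D h w) → D ≡ D'
  no-mover⇒≡ {D} {D'} {h} tm still = ⊆-antisym D⊆D' D'⊆D
    where
    fixed : ∀ {w} → w ∈ D → h w ≡ w
    fixed {w} w∈D with h w ≟ w
    ... | yes hw≡w = hw≡w
    ... | no hw≢w = contradiction (w∈D , hw≢w) still
    D⊆D' : ∀ {w} → w ∈ D → w ∈ D'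
    D⊆D' w∈D = subst (_∈ D') (fixed w∈D) (maps-into tm w∈D)
    D'⊆D : ∀ {y} → y ∈ D' → y ∈ D
    D'⊆D y∈D' with surjective tm y∈D'
    ... | w , w∈D , hw≡y = subst (_∈ D) (trans (sym (fixed w∈D)) hw≡y) w∈D

  module AfterSlide {D D' h x} (tm : TokenMap D D' h) (x∈D : x ∈ D) (hx∉D : h x ∉ D) where

    D₁ : Subset n
    D₁ = slide x (h x) D

    -- The token slid onto h x has already reached its target; the others still follow h.
    h₁ : Fin n → Fin n
    h₁ = h [ h x ↦ h x ]

    tokenMap : TokenMap D₁ D' h₁
    tokenMap = record
      { maps-into  = maps-into′
      ; near       = near′
      ; injective  = injective′
      ; surjective = surjective′
      }
      where
      maps-into′ : ∀ {w} → w ∈ D₁ → h₁ w ∈ D'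
      maps-into′ {w} w∈ with w ≟ h x
      ... | yes _ = maps-into tm x∈D
      ... | no w≢hx = maps-into tm (proj₁ (∈slide⁻ w∈ w≢hx))
      near′ : ∀ {w} → w ∈ D₁ → Dist≤1 g w (h₁ w)
      near′ {w} w∈ with w ≟ h x
      ... | yes w≡hx = inj₁ w≡hx
      ... | no w≢hx = near tm (proj₁ (∈slide⁻ w∈ w≢hx))
      injective′ : ∀ {w w'} → w ∈ D₁ → w' ∈ D₁ → h₁ w ≡ h₁ w' → w ≡ w'
      injective′ {w} {w'} w∈ w'∈ eq with w ≟ h x | w' ≟ h x
      ... | yes w≡hx | yes w'≡hx = trans w≡hx (sym w'≡hx)
      ... | yes _ | no w'≢hx =
        let (w'∈D , w'≢x) = ∈slide⁻ w'∈ w'≢hx in contradiction (sym (injective tm x∈D w'∈D eq)) w'≢x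
      ... | no w≢hx | yes _ =
        let (w∈D , w≢x) = ∈slide⁻ w∈ w≢hx in contradiction (injective tm w∈D x∈D eq) w≢x
      ... | no w≢hx | no w'≢hx =
        injective tm (proj₁ (∈slide⁻ w∈ w≢hx)) (proj₁ (∈slide⁻ w'∈ w'≢hx)) eq
      surjective′ : ∀ {y} → y ∈ D' → ∃[ w ] (w ∈ D₁ × h₁ w ≡ y)
      surjective′ y∈D' with surjective tm y∈D'
      ... | w , w∈D , hw≡y with w ≟ x
      ...   | yes refl = h x , v∈slide x (h x) D , trans ([↦]-at h (h x) (h x)) hw≡y
      ...   | no w≢x = w , ∈slide⁺ w∈D w≢x , trans ([↦]-other h w≢hx) hw≡y
        where
        w≢hx : w ≢ h x
        w≢hx w≡hx = hx∉D (subst (_∈ D) w≡hx w∈D)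

    mover-before : ∀ {w} → Moves D₁ h₁ w → w ≢ x × Moves D h w
    mover-before {w} (w∈ , h₁w≢w) with w ≟ h x
    ... | yes w≡hx = contradiction (sym w≡hx) h₁w≢w
    ... | no w≢hx with ∈slide⁻ w∈ w≢hx
    ...   | w∈D , w≢x = w≢x , w∈D , h₁w≢w

  slide-independent : ∀ {D u v} → Independent g D → (∀ {w} → w ∈ D → w ≢ u → ¬ Adj g v w) →
                      Independent g (slide u v D)
  slide-independent {v = v} indD v≁D w w' w∈ w'∈ with w ≟ v | w' ≟ v
  ... | yes refl | yes refl = irrefl g
  ... | yes refl | no w'≢v = uncurry v≁D (∈slide⁻ w'∈ w'≢v)
  ... | no w≢v | yes refl = uncurry v≁D (∈slide⁻ w∈ w≢v) ∘ Adj-sym g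
  ... | no w≢v | no w'≢v = indD w w' (proj₁ (∈slide⁻ w∈ w≢v)) (proj₁ (∈slide⁻ w'∈ w'≢v))

  TSPath : ℕ → Subset n → Subset n → Set
  TSPath k = Star (Step g k (TSMove g))

  AtMostOneMover : Subset n → (Fin n → Fin n) → Set
  AtMostOneMover D h = ∀ {x y} → Moves D h x → Moves D h y → x ≡ y

  mover-slide-step : ∀ {k D D' h x} → IndepOfSize g k D → IndepOfSize g k (slide x (h x) D) →
                     TokenMap D D' h → Moves D h x → Step g k (TSMove g) D (slide x (h x) D)
  mover-slide-step iD iD₁ tm mx =
    iD , iD₁ , _ , _ , proj₁ mx , mover-target∉ (proj₁ iD) tm mx , mover-adj tm mx , refl

  atMostOneMover⇒TSPath : ∀ {k D D' h} → IndepOfSize g k D → IndepOfSize g k D' →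
                          TokenMap D D' h → AtMostOneMover D h → TSPath k D D'
  atMostOneMover⇒TSPath {k} {D} {D'} {h} iD iD' tm unique with any? (moves? D h)
  ... | no none = subst (TSPath k D) (no-mover⇒≡ tm (none ∘ (_ ,_))) ε
  ... | yes (x , mx) =
    subst (TSPath k D) D₁≡D' (mover-slide-step iD (subst (IndepOfSize g k) (sym D₁≡D') iD') tm mx ◅ ε)
    where
    open AfterSlide tm (proj₁ mx) (mover-target∉ (proj₁ iD) tm mx)
    D₁≡D' : D₁ ≡ D'
    D₁≡D' = no-mover⇒≡ tokenMap (λ m₁ → let (w≢x , mw) = mover-before m₁ in w≢x (unique mw mx))

module _ {n : ℕ} (G : SplitGraph n) where

  private
    g : Graph n
    g = graph G

  open TokenMap

  adj-from-I⇒C : ∀ {u v} → Adj g u v → inC G u ≡ false → inC G v ≡ true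
  adj-from-I⇒C {u} {v} u~v u∈I with inC G v in v∈?
  ... | true = refl
  ... | false = contradiction u~v (I-indep G u v u∈I v∈?)

  independent-clique-unique : ∀ {E u v} → Independent g E → u ∈ E → v ∈ E →
                              inC G u ≡ true → inC G v ≡ true → u ≡ v
  independent-clique-unique {u = u} {v} indE u∈E v∈E u∈C v∈C with u ≟ v
  ... | yes u≡v = u≡v
  ... | no u≢v = contradiction (C-clique G u v u∈C v∈C u≢v) (indE u v u∈E v∈E)

  others-in-I : ∀ {E c w} → Independent g E → c ∈ E → inC G c ≡ true →
                w ∈ E → w ≢ c → inC G w ≡ false
  others-in-I indE c∈E c∈C w∈E w≢c =
    ¬-not (λ w∈C → w≢c (independent-clique-unique indE w∈E c∈E w∈C c∈C))

  I-mover-lands-in-C : ∀ {D D' h w} → TokenMap g D D' h → Moves g D h w →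
                       inC G w ≡ false → inC G (h w) ≡ true
  I-mover-lands-in-C tm mw = adj-from-I⇒C (mover-adj g tm mw)

  NoCliqueMover : Subset n → (Fin n → Fin n) → Set
  NoCliqueMover D h = ∀ {c} → inC G c ≡ true → ¬ Moves g D h c

  noCliqueMover⇒atMostOneMover : ∀ {D D' h} → Independent g D' → TokenMap g D D' h →
                                 NoCliqueMover D h → AtMostOneMover g D h
  noCliqueMover⇒atMostOneMover {D} {h = h} indD' tm still mx my =
    injective tm (proj₁ mx) (proj₁ my)
      (independent-clique-unique indD' (maps-into tm (proj₁ mx)) (maps-into tm (proj₁ my))
        (lands-in-C mx) (lands-in-C my))
    where
    lands-in-C : ∀ {x} → Moves g D h x → inC G (h x) ≡ true
    lands-in-C mx = I-mover-lands-in-C tm mx (¬-not (λ x∈C → still x∈C mx))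

  clique-slide-independent : ∀ {D D' h c} → Independent g D → Independent g D' → TokenMap g D D' h →
                             inC G c ≡ true → Moves g D h c → Independent g (slide c (h c) D)
  clique-slide-independent {D} {D'} {h} {c} indD indD' tm c∈C (c∈D , _) = slide-independent g indD hc≁
    where
    -- A fixed w shares D' with h c.  Otherwise w ∈ I, and if h c ∈ C then w lands in C as
    -- well, on the only clique vertex of D', which is h c.
    hc≁ : ∀ {w} → w ∈ D → w ≢ c → ¬ Adj g (h c) w
    hc≁ {w} w∈D w≢c with h w ≟ w | inC G (h c) in hc∈?
    ... | yes hw≡w | _ = indD' (h c) w (maps-into tm c∈D) (subst (_∈ D') hw≡w (maps-into tm w∈D))
    ... | no _ | false = I-indep G (h c) w hc∈? (others-in-I indD c∈D c∈C w∈D w≢c)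
    ... | no hw≢w | true = λ _ → w≢c (injective tm w∈D c∈D hw≡hc)
      where
      hw≡hc : h w ≡ h c
      hw≡hc = independent-clique-unique indD' (maps-into tm w∈D) (maps-into tm c∈D)
                (I-mover-lands-in-C tm (w∈D , hw≢w) (others-in-I indD c∈D c∈C w∈D w≢c)) hc∈?

  tokenMap⇒TSPath : ∀ {k D D' h} → IndepOfSize g k D → IndepOfSize g k D' →
                    TokenMap g D D' h → TSPath g k D D'
  tokenMap⇒TSPath {k} {D} {h = h} iD@(indD , _) iD'@(indD' , _) tm
    with any? (λ c → (inC G c ≟ᵇ true) ×-dec moves? g D h c)
  ... | no none =
    atMostOneMover⇒TSPath g iD iD' tm
      (noCliqueMover⇒atMostOneMover indD' tm (λ c∈C mc → none (_ , c∈C , mc)))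
  ... | yes (c , c∈C , mc@(c∈D , _)) =
    mover-slide-step g iD iD₁ tm mc ◅
    atMostOneMover⇒TSPath g iD₁ iD' tokenMap (noCliqueMover⇒atMostOneMover indD' tokenMap still)
    where
    hc∉D : h c ∉ D
    hc∉D = mover-target∉ g indD tm mc
    open AfterSlide g tm c∈D hc∉D
    iD₁ : IndepOfSize g k D₁
    iD₁ = clique-slide-independent indD indD' tm c∈C mc , trans (∣slide∣ c∈D hc∉D) (proj₂ iD)
    still : NoCliqueMover D₁ h₁
    still w∈C m₁ with mover-before m₁
    ... | w≢c , w∈D , _ = w≢c (independent-clique-unique indD w∈D c∈D w∈C c∈C)

  tjStep⇒TSPath : ∀ {k D D'} → Step g k (TJMove g) D D' → TSPath g k D D'
  tjStep⇒TSPath (iD , iD' , mv) = tokenMap⇒TSPath iD iD' (proj₂ (tjMove⇒tokenMap g mv))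

lemma4 : {n : ℕ} (G : SplitGraph n) (k : ℕ) (Is It : Subset n) →
    IndepOfSize (graph G) k Is → IndepOfSize (graph G) k It →
    (Reconf (graph G) k (TSMove (graph G)) Is It → Reconf (graph G) k (TJMove (graph G)) Is It) ×
    (Reconf (graph G) k (TJMove (graph G)) Is It → Reconf (graph G) k (TSMove (graph G)) Is It)
lemma4 G k Is It _ _ =
  (λ (iS , iT , path) → iS , iT , map (tsStep⇒tjStep (graph G)) path) ,
  (λ (iS , iT , path) → iS , iT , concat (map (tjStep⇒TSPath G) path))
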